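{- Let $G$ be a graph and let $\mathcal{P}$ be one of $\mathcal{V}$, $\mathcal{V}_{\rm o}$, $\mathcal{V}_{\rm t}$. If $X_1,\ldots,X_n$ are all the maximal (with respect to inclusion) mutual-visibility sets (respectively outer mutual-visibility sets, respectively total mutual-visibility sets) of $G$, then $$\mathcal{P}(G)=\sum_{k=1}^{n}(-1)^{k-1}\sum_{\{i_1,\ldots,i_k\}\subseteq[n]} (1+x)^{|X_{i_1}\cap\cdots\cap X_{i_k}|}.$$
   Context: For a graph $G$ and $X\subseteq V(G)$, two vertices $x,y$ are $X$-visible if there is a shortest $x,y$-path in $G$ with no internal vertex in $X$. Write $\overline{X}=V(G)\setminus X$. $X$ is a mutual-visibility set if any two vertices of $X$ are $X$-visible; a total mutual-visibility set if any two vertices of $V(G)$ are $X$-visible; an outer mutual-visibility set if any two vertices of $X$ are $X$-visible and any $x\in X$, $y\in\overline{X}$ are $X$-visible. $\mathcal{V}(G)=\sum_{i\ge0} r_i x^i$ where $r_i$ is the number of mutual-visibility sets of $G$ of cardinality $i$; $\mathcal{V}_{\rm o}(G)$ and $\mathcal{V}_{\rm t}(G)$ are defined analogously by counting outer, resp. total, mutual-visibility sets. $[n]=\{1,\ldots,n\}$. -}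

module Defs where

open import Data.Nat as ℕ using (ℕ; zero; suc; _≤_; _∸_)
open import Data.Integer as ℤ using (ℤ; +_; -[1+_])
open import Data.Fin using (Fin; zero; suc)
open import Data.Fin.Subset using (Subset; _∈_; _∉_; _⊆_; _∩_; ⊤; ∣_∣)
open import Data.Bool using (Bool; true; false; if_then_else_)
open import Data.Vec using (Vec; []; _∷_)
open import Data.List as List using (List; []; _∷_; _++_; [_]; length; filter; upTo)
open import Data.List.Relation.Unary.All using (All)
open import Data.Product using (Σ; _×_)
open import Data.Sum using (_⊎_)
open import Relation.Nullary using (Dec)
open import Relation.Nullary.Decidable using (_×-dec_)
open import Relation.Binary.PropositionalEquality using (_≡_)

record Graph : Set where
  field
    order  : ℕ
    adj    : Fin order → Fin order → Bool
    sym    : ∀ u v → adj u v ≡ adj v u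
    irrefl : ∀ v → adj v v ≡ false

open Graph public

module _ (G : Graph) where
  private V = Fin (order G)

  -- IsWalk x ws y : x, ws₁, …, wsₖ, y is a walk (ws = internal vertices);
  -- its length (number of edges) is suc (length ws).
  IsWalk : V → List V → V → Set
  IsWalk x []       y = adj G x y ≡ true
  IsWalk x (w ∷ ws) y = (adj G x w ≡ true) × IsWalk w ws y

  -- a shortest x,y-walk of positive length (hence a shortest path)
  IsShortest : V → List V → V → Set
  IsShortest x ws y =
    IsWalk x ws y × (∀ ws′ → IsWalk x ws′ y → length ws ≤ length ws′)

  -- x,y are X-visible: a shortest x,y-path with no internal vertex in X
  -- (for x = y the trivial path has no internal vertex)
  Visible : Subset (order G) → V → V → Set
  Visible X x y =
    x ≡ y ⊎ Σ (List V) (λ ws → IsShortest x ws y × All (λ w → w ∉ X) ws)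

  IsMV : Subset (order G) → Set
  IsMV X = ∀ x y → x ∈ X → y ∈ X → Visible X x y

  IsOuterMV : Subset (order G) → Set
  IsOuterMV X = IsMV X × (∀ x y → x ∈ X → y ∉ X → Visible X x y)

  IsTotalMV : Subset (order G) → Set
  IsTotalMV X = ∀ x y → Visible X x y

data Kind : Set where
  mutualVis outerVis totalVis : Kind

VisProp : Kind → (G : Graph) → Subset (order G) → Set
VisProp mutualVis G X = IsMV G X
VisProp outerVis  G X = IsOuterMV G X
VisProp totalVis  G X = IsTotalMV G X

IsMaximal : Kind → (G : Graph) → Subset (order G) → Set
IsMaximal κ G X = VisProp κ G X × (∀ Y → VisProp κ G Y → X ⊆ Y → Y ≡ X)

subsets : (n : ℕ) → List (Subset n)
subsets zero    = [ [] ]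
subsets (suc n) = List.map (false ∷_) (subsets n) ++ List.map (true ∷_) (subsets n)

-- r_i : number of sets X ⊆ V(G) with |X| = i satisfying the property
-- (given any decision procedure for the property; the count does not depend on it)
countSets : ∀ {m} {P : Subset m → Set} → (∀ X → Dec (P X)) → ℕ → ℕ
countSets {m} dec i = length (filter (λ X → dec X ×-dec (∣ X ∣ ℕ.≟ i)) (subsets m))

-- X_{i₁} ∩ ⋯ ∩ X_{iₖ} for S = {i₁,…,iₖ} ⊆ [n]
bigCap : ∀ {n m} → (Fin n → Subset m) → Subset n → Subset m
bigCap {zero}  X []      = ⊤
bigCap {suc n} X (b ∷ S) =
  if b then X zero ∩ bigCap (λ i → X (suc i)) S else bigCap (λ i → X (suc i)) S

-- Polynomials over ℤ as coefficient lists (constant term first)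

Poly : Set
Poly = List ℤ

infixl 6 _+ₚ_
infixl 7 _*ₚ_
infixr 8 _^ₚ_

_+ₚ_ : Poly → Poly → Poly
[]      +ₚ q       = q
(a ∷ p) +ₚ []      = a ∷ p
(a ∷ p) +ₚ (b ∷ q) = (a ℤ.+ b) ∷ (p +ₚ q)

_*ₚ_ : Poly → Poly → Poly
[]      *ₚ q = []
(a ∷ p) *ₚ q = List.map (a ℤ.*_) q +ₚ ((+ 0) ∷ (p *ₚ q))

_^ₚ_ : Poly → ℕ → Poly
p ^ₚ zero  = [ + 1 ]
p ^ₚ suc k = p *ₚ (p ^ₚ k)

sumₚ : List Poly → Poly
sumₚ = List.foldr _+ₚ_ []

const : ℤ → Poly
const c = [ c ]

1+x : Poly
1+x = + 1 ∷ + 1 ∷ []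

coeff : Poly → ℕ → ℤ
coeff []      _       = + 0
coeff (a ∷ p) zero    = a
coeff (a ∷ p) (suc i) = coeff p i

inclExcl : ∀ {m} (n : ℕ) → (Fin n → Subset m) → Poly
inclExcl n X =
  sumₚ (List.map
    (λ k → const (-[1+ 0 ] ℤ.^ (k ∸ 1)) *ₚ
           sumₚ (List.map (λ S → 1+x ^ₚ ∣ bigCap X S ∣)
                          (filter (λ S → ∣ S ∣ ℕ.≟ k) (subsets n))))
    (List.map suc (upTo n)))

-- Every visibility property is hereditary, so by finiteness a set has the property exactly
-- when it lies in one of the maximal sets X₁, …, Xₙ. The j-sets lying in some Xᵢ are counted
-- by inclusion–exclusion over the nonempty index sets S, and the j-subsets of ⋂_{i∈S} Xᵢ are
-- counted by the coefficient of xʲ in (1 + x)^|⋂_{i∈S} Xᵢ|.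

module Submission where

open import Defs hiding (sym)
open import Data.Nat as ℕ using (ℕ; zero; suc; _<_; _∸_; _≡ᵇ_; s≤s)
import Data.Nat.Properties as ℕP
open import Data.Nat.Induction using (<-wellFounded)
open import Data.Integer as ℤ using (ℤ; +_; -[1+_]; _+_; _*_)
import Data.Integer.Properties as ℤP
open import Data.Fin using (Fin; zero; suc)
open import Data.Fin.Subset using (Subset; _∈_; _∉_; _⊆_; _⊂_; _⊄_; _∩_; ⊤; ∣_∣; inside; outside)
open import Data.Fin.Subset.Properties
  using ( _∈?_; _⊂?_; ⊆-refl; ⊆-trans; ⊆-antisym; ∣p∣≤n; p⊆q⇒∣p∣≤∣q∣; p⊂q⇒p⊆q
        ; drop-∷-⊆; drop-∷-⊂; out⊆; s⊆s)
open import Data.Bool using (Bool; true; false; _∧_; _∨_; not)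
open import Data.Bool.Properties using (∧-zeroʳ)
open import Data.Vec using ([]; _∷_; here; tabulate)
open import Data.List as List using (List; []; _∷_; [_]; _++_; filter; upTo)
import Data.List.Properties as ListP
import Data.List.Relation.Unary.All as All
open import Data.List.Relation.Unary.Any as Any using (any?)
open import Data.List.Membership.Propositional using (lose) renaming (_∈_ to _List∈_)
open import Data.List.Membership.Propositional.Properties using (∈-++⁺ˡ; ∈-++⁺ʳ; ∈-map⁺)
open import Data.Product using (_×_; _,_; proj₁; ∃)
open import Data.Sum using (inj₁; inj₂)
open import Induction.WellFounded using (Acc; acc)
open import Relation.Nullary using (Dec; yes; no; does; contradiction)
open import Relation.Nullary.Decidable using (_×-dec_)
open import Relation.Binary.PropositionalEquality hiding ([_])
open import Function.Definitions using (Injective)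
open import Algebra.Properties.CommutativeSemigroup ℤP.+-commutativeSemigroup using (interchange)

𝟙 : Bool → ℤ
𝟙 true  = + 1
𝟙 false = + 0

𝟙-∧ : ∀ a b → 𝟙 (a ∧ b) ≡ 𝟙 a * 𝟙 b
𝟙-∧ true  b = sym (ℤP.*-identityˡ _)
𝟙-∧ false b = refl

∑ : ∀ {A : Set} → (A → ℤ) → List A → ℤ
∑ f []       = + 0
∑ f (x ∷ xs) = f x + ∑ f xs

syntax ∑ (λ x → e) xs = ∑[ x ∈ xs ] e

module _ {A : Set} where

  ∑-cong : ∀ {f g : A → ℤ} xs → (∀ x → f x ≡ g x) → ∑ f xs ≡ ∑ g xs
  ∑-cong []       f≗g = refl
  ∑-cong (x ∷ xs) f≗g = cong₂ _+_ (f≗g x) (∑-cong xs f≗g)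

  ∑-zero : ∀ {f : A → ℤ} xs → (∀ x → f x ≡ + 0) → ∑ f xs ≡ + 0
  ∑-zero []       f≗0 = refl
  ∑-zero (x ∷ xs) f≗0 rewrite f≗0 x = trans (ℤP.+-identityˡ _) (∑-zero xs f≗0)

  ∑-++ : ∀ (f : A → ℤ) xs ys → ∑ f (xs ++ ys) ≡ ∑ f xs + ∑ f ys
  ∑-++ f []       ys = sym (ℤP.+-identityˡ _)
  ∑-++ f (x ∷ xs) ys rewrite ∑-++ f xs ys = sym (ℤP.+-assoc (f x) _ _)

  ∑-+ : ∀ (f g : A → ℤ) xs → ∑[ x ∈ xs ] (f x + g x) ≡ ∑ f xs + ∑ g xs
  ∑-+ f g []       = refl
  ∑-+ f g (x ∷ xs) rewrite ∑-+ f g xs = interchange (f x) (g x) (∑ f xs) (∑ g xs)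

  ∑-*ˡ : ∀ c (f : A → ℤ) xs → ∑[ x ∈ xs ] (c * f x) ≡ c * ∑ f xs
  ∑-*ˡ c f []       = sym (ℤP.*-zeroʳ c)
  ∑-*ˡ c f (x ∷ xs) rewrite ∑-*ˡ c f xs = sym (ℤP.*-distribˡ-+ c (f x) _)

  ∑-*ʳ : ∀ c (f : A → ℤ) xs → ∑[ x ∈ xs ] (f x * c) ≡ ∑ f xs * c
  ∑-*ʳ c f []       = refl
  ∑-*ʳ c f (x ∷ xs) rewrite ∑-*ʳ c f xs = sym (ℤP.*-distribʳ-+ c (f x) _)

  ∑-filter : ∀ {P : A → Set} (P? : ∀ x → Dec (P x)) (f : A → ℤ) xs →
             ∑ f (filter P? xs) ≡ ∑[ x ∈ xs ] (𝟙 (does (P? x)) * f x)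
  ∑-filter P? f []       = refl
  ∑-filter P? f (x ∷ xs) with does (P? x)
  ... | true  = cong₂ _+_ (sym (ℤP.*-identityˡ (f x))) (∑-filter P? f xs)
  ... | false = trans (∑-filter P? f xs) (sym (ℤP.+-identityˡ _))

  length-filter : ∀ {P : A → Set} (P? : ∀ x → Dec (P x)) xs →
                  + List.length (filter P? xs) ≡ ∑[ x ∈ xs ] 𝟙 (does (P? x))
  length-filter P? []       = refl
  length-filter P? (x ∷ xs) with does (P? x)
  ... | true  = cong (_+_ (+ 1)) (length-filter P? xs)
  ... | false = trans (length-filter P? xs) (sym (ℤP.+-identityˡ _))

∑-map : ∀ {A B : Set} (f : B → ℤ) (g : A → B) xs → ∑ f (List.map g xs) ≡ ∑[ x ∈ xs ] f (g x)
∑-map f g []       = refl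
∑-map f g (x ∷ xs) = cong (_+_ (f (g x))) (∑-map f g xs)

∑-comm : ∀ {A B : Set} (f : A → B → ℤ) xs ys →
         ∑[ x ∈ xs ] ∑[ y ∈ ys ] f x y ≡ ∑[ y ∈ ys ] ∑[ x ∈ xs ] f x y
∑-comm f []       ys = sym (∑-zero ys (λ _ → refl))
∑-comm f (x ∷ xs) ys rewrite ∑-comm f xs ys = sym (∑-+ (f x) (λ y → ∑[ x ∈ xs ] f x y) ys)

∑-upTo-suc : ∀ (f : ℕ → ℤ) n → ∑ f (upTo (suc n)) ≡ f 0 + ∑[ k ∈ upTo n ] f (suc k)
∑-upTo-suc f n =
  trans (cong (λ ks → f 0 + ∑ f ks) (sym (ListP.map-upTo suc n))) (cong (_+_ (f 0)) (∑-map f suc (upTo n)))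

∑-upTo-𝟙 : ∀ (f : ℕ → ℤ) {s n} → s < n → ∑[ k ∈ upTo n ] (𝟙 (s ≡ᵇ k) * f k) ≡ f s
∑-upTo-𝟙 f {zero} {suc n} _ = begin
  ∑[ k ∈ upTo (suc n) ] (𝟙 (0 ≡ᵇ k) * f k)
    ≡⟨ ∑-upTo-suc (λ k → 𝟙 (0 ≡ᵇ k) * f k) n ⟩
  + 1 * f 0 + ∑[ k ∈ upTo n ] (+ 0 * f (suc k))
    ≡⟨ cong₂ _+_ (ℤP.*-identityˡ (f 0)) (∑-zero (upTo n) (λ _ → refl)) ⟩
  f 0 + + 0
    ≡⟨ ℤP.+-identityʳ (f 0) ⟩
  f 0 ∎
  where open ≡-Reasoning
∑-upTo-𝟙 f {suc s} {suc n} (s≤s s<n) = begin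
  ∑[ k ∈ upTo (suc n) ] (𝟙 (suc s ≡ᵇ k) * f k)
    ≡⟨ ∑-upTo-suc (λ k → 𝟙 (suc s ≡ᵇ k) * f k) n ⟩
  + 0 + ∑[ k ∈ upTo n ] (𝟙 (s ≡ᵇ k) * f (suc k))
    ≡⟨ ℤP.+-identityˡ _ ⟩
  ∑[ k ∈ upTo n ] (𝟙 (s ≡ᵇ k) * f (suc k))
    ≡⟨ ∑-upTo-𝟙 (λ k → f (suc k)) s<n ⟩
  f (suc s) ∎
  where open ≡-Reasoning

∑-subsets-suc : ∀ {n} (f : Subset (suc n) → ℤ) →
  ∑ f (subsets (suc n)) ≡ ∑[ S ∈ subsets n ] f (outside ∷ S) + ∑[ S ∈ subsets n ] f (inside ∷ S)
∑-subsets-suc {n} f = begin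
  ∑ f (List.map (outside ∷_) (subsets n) ++ List.map (inside ∷_) (subsets n))
    ≡⟨ ∑-++ f (List.map (outside ∷_) (subsets n)) _ ⟩
  ∑ f (List.map (outside ∷_) (subsets n)) + ∑ f (List.map (inside ∷_) (subsets n))
    ≡⟨ cong₂ _+_ (∑-map f (outside ∷_) (subsets n)) (∑-map f (inside ∷_) (subsets n)) ⟩
  ∑[ S ∈ subsets n ] f (outside ∷ S) + ∑[ S ∈ subsets n ] f (inside ∷ S) ∎
  where open ≡-Reasoning

infix 6.5 _⊆ᵇ_

_⊆ᵇ_ : ∀ {m} → Subset m → Subset m → Bool
[]            ⊆ᵇ []      = true
(outside ∷ Y) ⊆ᵇ (_ ∷ Z) = Y ⊆ᵇ Z
(inside  ∷ Y) ⊆ᵇ (b ∷ Z) = b ∧ Y ⊆ᵇ Z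

⊆ᵇ⇒⊆ : ∀ {m} (Y Z : Subset m) → Y ⊆ᵇ Z ≡ true → Y ⊆ Z
⊆ᵇ⇒⊆ []            []            _  ()
⊆ᵇ⇒⊆ (outside ∷ Y) (_ ∷ Z)       eq = out⊆ (⊆ᵇ⇒⊆ Y Z eq)
⊆ᵇ⇒⊆ (inside  ∷ Y) (inside ∷ Z)  eq = s⊆s (⊆ᵇ⇒⊆ Y Z eq)
⊆ᵇ⇒⊆ (inside  ∷ Y) (outside ∷ Z) ()

⊆⇒⊆ᵇ : ∀ {m} (Y Z : Subset m) → Y ⊆ Z → Y ⊆ᵇ Z ≡ true
⊆⇒⊆ᵇ []            []            _   = refl
⊆⇒⊆ᵇ (outside ∷ Y) (_ ∷ Z)       Y⊆Z = ⊆⇒⊆ᵇ Y Z (drop-∷-⊆ Y⊆Z)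
⊆⇒⊆ᵇ (inside  ∷ Y) (inside ∷ Z)  Y⊆Z = ⊆⇒⊆ᵇ Y Z (drop-∷-⊆ Y⊆Z)
⊆⇒⊆ᵇ (inside  ∷ Y) (outside ∷ Z) Y⊆Z with Y⊆Z here
... | ()

⊆ᵇ-⊤ : ∀ {m} (Y : Subset m) → Y ⊆ᵇ ⊤ ≡ true
⊆ᵇ-⊤ []            = refl
⊆ᵇ-⊤ (outside ∷ Y) = ⊆ᵇ-⊤ Y
⊆ᵇ-⊤ (inside  ∷ Y) = ⊆ᵇ-⊤ Y

⊆ᵇ-∩ : ∀ {m} (Y A B : Subset m) → Y ⊆ᵇ A ∩ B ≡ Y ⊆ᵇ A ∧ Y ⊆ᵇ B
⊆ᵇ-∩ []            []            []            = refl
⊆ᵇ-∩ (outside ∷ Y) (_ ∷ A)       (_ ∷ B)       = ⊆ᵇ-∩ Y A B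
⊆ᵇ-∩ (inside  ∷ Y) (inside ∷ A)  (inside  ∷ B) = ⊆ᵇ-∩ Y A B
⊆ᵇ-∩ (inside  ∷ Y) (inside ∷ A)  (outside ∷ B) = sym (∧-zeroʳ (Y ⊆ᵇ A))
⊆ᵇ-∩ (inside  ∷ Y) (outside ∷ A) (_ ∷ B)       = refl

⊆ᵇ-bigCap : ∀ {m n} (X : Fin n → Subset m) S Y →
            Y ⊆ᵇ bigCap X S ≡ S ⊆ᵇ tabulate (λ i → Y ⊆ᵇ X i)
⊆ᵇ-bigCap {n = zero}  X []            Y = ⊆ᵇ-⊤ Y
⊆ᵇ-bigCap {n = suc n} X (outside ∷ S) Y = ⊆ᵇ-bigCap (λ i → X (suc i)) S Y
⊆ᵇ-bigCap {n = suc n} X (inside  ∷ S) Y =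
  trans (⊆ᵇ-∩ Y (X zero) _) (cong (Y ⊆ᵇ X zero ∧_) (⊆ᵇ-bigCap (λ i → X (suc i)) S Y))

anyᵇ : ∀ {n} → (Fin n → Bool) → Bool
anyᵇ {zero}  t = false
anyᵇ {suc n} t = t zero ∨ anyᵇ (λ i → t (suc i))

anyᵇ-intro : ∀ {n} (t : Fin n → Bool) i → t i ≡ true → anyᵇ t ≡ true
anyᵇ-intro t zero    ti rewrite ti = refl
anyᵇ-intro t (suc i) ti with t zero
... | true  = refl
... | false = anyᵇ-intro (λ i → t (suc i)) i ti

anyᵇ-elim : ∀ {n} (t : Fin n → Bool) → anyᵇ t ≡ true → ∃ λ i → t i ≡ true
anyᵇ-elim {suc n} t any with t zero in t0
... | true  = zero , t0
... | false with anyᵇ-elim (λ i → t (suc i)) any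
...   | i , ti = suc i , ti

sign : ℕ → ℤ
sign k = -[1+ 0 ] ℤ.^ k

ieWeight : ℕ → ℤ
ieWeight zero    = + 0
ieWeight (suc k) = sign k

∑-𝟙-∧ : ∀ {A : Set} (f : A → ℤ) (g : A → Bool) b xs →
        ∑[ x ∈ xs ] (f x * 𝟙 (b ∧ g x)) ≡ 𝟙 b * ∑[ x ∈ xs ] (f x * 𝟙 (g x))
∑-𝟙-∧ f g b xs = trans (∑-cong xs (λ x → *-𝟙-∧ (f x) b (g x))) (∑-*ˡ (𝟙 b) _ xs)
  where
  *-𝟙-∧ : ∀ x a b → x * 𝟙 (a ∧ b) ≡ 𝟙 a * (x * 𝟙 b)
  *-𝟙-∧ x true  b = sym (ℤP.*-identityˡ _)
  *-𝟙-∧ x false b = ℤP.*-zeroʳ x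

∑-sign-⊆ : ∀ n (t : Fin n → Bool) →
           ∑[ S ∈ subsets n ] (sign ∣ S ∣ * 𝟙 (S ⊆ᵇ tabulate t)) ≡ 𝟙 (not (anyᵇ t))
∑-sign-⊆ zero    t = refl
∑-sign-⊆ (suc n) t = begin
  ∑[ S ∈ subsets (suc n) ] (sign ∣ S ∣ * 𝟙 (S ⊆ᵇ tabulate t))
    ≡⟨ ∑-subsets-suc (λ S → sign ∣ S ∣ * 𝟙 (S ⊆ᵇ tabulate t)) ⟩
  ∑ f (subsets n) + ∑[ S ∈ subsets n ] (sign (suc ∣ S ∣) * 𝟙 (t zero ∧ S ⊆ᵇ T))
    ≡⟨ cong (_+_ (∑ f (subsets n))) (∑-𝟙-∧ (λ S → sign (suc ∣ S ∣)) (_⊆ᵇ T) (t zero) (subsets n)) ⟩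
  ∑ f (subsets n) + 𝟙 (t zero) * ∑[ S ∈ subsets n ] (-[1+ 0 ] * sign ∣ S ∣ * 𝟙 (S ⊆ᵇ T))
    ≡⟨ cong (λ s → ∑ f (subsets n) + 𝟙 (t zero) * s) (trans
         (∑-cong (subsets n) (λ S → ℤP.*-assoc -[1+ 0 ] (sign ∣ S ∣) _)) (∑-*ˡ -[1+ 0 ] f (subsets n))) ⟩
  ∑ f (subsets n) + 𝟙 (t zero) * (-[1+ 0 ] * ∑ f (subsets n))
    ≡⟨ cong (λ s → s + 𝟙 (t zero) * (-[1+ 0 ] * s)) (∑-sign-⊆ n (λ i → t (suc i))) ⟩
  𝟙 (not b) + 𝟙 (t zero) * (-[1+ 0 ] * 𝟙 (not b))
    ≡⟨ 𝟙-not-∨ (t zero) b ⟩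
  𝟙 (not (t zero ∨ b)) ∎
  where
  open ≡-Reasoning
  T = tabulate (λ i → t (suc i))
  b = anyᵇ (λ i → t (suc i))
  f : Subset n → ℤ
  f S = sign ∣ S ∣ * 𝟙 (S ⊆ᵇ T)
  𝟙-not-∨ : ∀ a b → 𝟙 (not b) + 𝟙 a * (-[1+ 0 ] * 𝟙 (not b)) ≡ 𝟙 (not (a ∨ b))
  𝟙-not-∨ true  true  = refl
  𝟙-not-∨ true  false = refl
  𝟙-not-∨ false true  = refl
  𝟙-not-∨ false false = refl

∑-ieWeight-⊆ : ∀ n (t : Fin n → Bool) →
               ∑[ S ∈ subsets n ] (ieWeight ∣ S ∣ * 𝟙 (S ⊆ᵇ tabulate t)) ≡ 𝟙 (anyᵇ t)
∑-ieWeight-⊆ zero    t = refl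
∑-ieWeight-⊆ (suc n) t = begin
  ∑[ S ∈ subsets (suc n) ] (ieWeight ∣ S ∣ * 𝟙 (S ⊆ᵇ tabulate t))
    ≡⟨ ∑-subsets-suc (λ S → ieWeight ∣ S ∣ * 𝟙 (S ⊆ᵇ tabulate t)) ⟩
  ∑[ S ∈ subsets n ] (ieWeight ∣ S ∣ * 𝟙 (S ⊆ᵇ T))
    + ∑[ S ∈ subsets n ] (sign ∣ S ∣ * 𝟙 (t zero ∧ S ⊆ᵇ T))
    ≡⟨ cong₂ _+_ (∑-ieWeight-⊆ n (λ i → t (suc i)))
                 (∑-𝟙-∧ (λ S → sign ∣ S ∣) (_⊆ᵇ T) (t zero) (subsets n)) ⟩
  𝟙 b + 𝟙 (t zero) * ∑[ S ∈ subsets n ] (sign ∣ S ∣ * 𝟙 (S ⊆ᵇ T))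
    ≡⟨ cong (λ s → 𝟙 b + 𝟙 (t zero) * s) (∑-sign-⊆ n (λ i → t (suc i))) ⟩
  𝟙 b + 𝟙 (t zero) * 𝟙 (not b)
    ≡⟨ 𝟙-∨ (t zero) b ⟩
  𝟙 (t zero ∨ b) ∎
  where
  open ≡-Reasoning
  T = tabulate (λ i → t (suc i))
  b = anyᵇ (λ i → t (suc i))
  𝟙-∨ : ∀ a b → 𝟙 b + 𝟙 a * 𝟙 (not b) ≡ 𝟙 (a ∨ b)
  𝟙-∨ true  true  = refl
  𝟙-∨ true  false = refl
  𝟙-∨ false true  = refl
  𝟙-∨ false false = refl

coeff-+ₚ : ∀ p q j → coeff (p +ₚ q) j ≡ coeff p j + coeff q j
coeff-+ₚ []      q       j       = sym (ℤP.+-identityˡ _)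
coeff-+ₚ (a ∷ p) []      j       = sym (ℤP.+-identityʳ _)
coeff-+ₚ (a ∷ p) (b ∷ q) zero    = refl
coeff-+ₚ (a ∷ p) (b ∷ q) (suc j) = coeff-+ₚ p q j

coeff-map-* : ∀ a p j → coeff (List.map (a *_) p) j ≡ a * coeff p j
coeff-map-* a []      j       = sym (ℤP.*-zeroʳ a)
coeff-map-* a (b ∷ p) zero    = refl
coeff-map-* a (b ∷ p) (suc j) = coeff-map-* a p j

coeff-const-*ₚ : ∀ a p j → coeff (const a *ₚ p) j ≡ a * coeff p j
coeff-const-*ₚ a p j = begin
  coeff (List.map (a *_) p +ₚ [ + 0 ]) j       ≡⟨ coeff-+ₚ (List.map (a *_) p) _ j ⟩
  coeff (List.map (a *_) p) j + coeff [ + 0 ] j  ≡⟨ cong₂ _+_ (coeff-map-* a p j) (coeff-[0] j) ⟩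
  a * coeff p j + + 0                          ≡⟨ ℤP.+-identityʳ _ ⟩
  a * coeff p j                                ∎
  where
  open ≡-Reasoning
  coeff-[0] : ∀ j → coeff [ + 0 ] j ≡ + 0
  coeff-[0] zero    = refl
  coeff-[0] (suc j) = refl

-- + 0 ∷ p is x · p.
coeff-1+x-*ₚ : ∀ p j → coeff (1+x *ₚ p) j ≡ coeff p j + coeff (+ 0 ∷ p) j
coeff-1+x-*ₚ p j = begin
  coeff (List.map (+ 1 *_) p +ₚ (+ 0 ∷ const (+ 1) *ₚ p)) j
    ≡⟨ coeff-+ₚ (List.map (+ 1 *_) p) _ j ⟩
  coeff (List.map (+ 1 *_) p) j + coeff (+ 0 ∷ const (+ 1) *ₚ p) j
    ≡⟨ cong₂ _+_ (trans (coeff-map-* (+ 1) p j) (ℤP.*-identityˡ _)) (x*ₚ-cong j) ⟩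
  coeff p j + coeff (+ 0 ∷ p) j ∎
  where
  open ≡-Reasoning
  x*ₚ-cong : ∀ j → coeff (+ 0 ∷ const (+ 1) *ₚ p) j ≡ coeff (+ 0 ∷ p) j
  x*ₚ-cong zero    = refl
  x*ₚ-cong (suc j) = trans (coeff-const-*ₚ (+ 1) p j) (ℤP.*-identityˡ _)

coeff-sumₚ : ∀ ps j → coeff (sumₚ ps) j ≡ ∑[ p ∈ ps ] coeff p j
coeff-sumₚ []       j = refl
coeff-sumₚ (p ∷ ps) j = trans (coeff-+ₚ p (sumₚ ps) j) (cong (_+_ (coeff p j)) (coeff-sumₚ ps j))

∑-⊆-size≡coeff-1+x^ : ∀ {m} (Z : Subset m) j →
  ∑[ Y ∈ subsets m ] (𝟙 (Y ⊆ᵇ Z) * 𝟙 (∣ Y ∣ ≡ᵇ j)) ≡ coeff (1+x ^ₚ ∣ Z ∣) j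
∑-⊆-size≡coeff-1+x^ []            zero    = refl
∑-⊆-size≡coeff-1+x^ []            (suc j) = refl
∑-⊆-size≡coeff-1+x^ {suc m} (outside ∷ Z) j = begin
  ∑[ Y ∈ subsets (suc m) ] (𝟙 (Y ⊆ᵇ (outside ∷ Z)) * 𝟙 (∣ Y ∣ ≡ᵇ j))
    ≡⟨ ∑-subsets-suc (λ Y → 𝟙 (Y ⊆ᵇ (outside ∷ Z)) * 𝟙 (∣ Y ∣ ≡ᵇ j)) ⟩
  ∑[ Y ∈ subsets m ] (𝟙 (Y ⊆ᵇ Z) * 𝟙 (∣ Y ∣ ≡ᵇ j))
    + ∑[ Y ∈ subsets m ] (+ 0 * 𝟙 (suc ∣ Y ∣ ≡ᵇ j))
    ≡⟨ cong₂ _+_ (∑-⊆-size≡coeff-1+x^ Z j) (∑-zero (subsets m) (λ _ → refl)) ⟩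
  coeff (1+x ^ₚ ∣ Z ∣) j + + 0
    ≡⟨ ℤP.+-identityʳ _ ⟩
  coeff (1+x ^ₚ ∣ Z ∣) j ∎
  where open ≡-Reasoning
∑-⊆-size≡coeff-1+x^ {suc m} (inside ∷ Z) j = begin
  ∑[ Y ∈ subsets (suc m) ] (𝟙 (Y ⊆ᵇ (inside ∷ Z)) * 𝟙 (∣ Y ∣ ≡ᵇ j))
    ≡⟨ ∑-subsets-suc (λ Y → 𝟙 (Y ⊆ᵇ (inside ∷ Z)) * 𝟙 (∣ Y ∣ ≡ᵇ j)) ⟩
  ∑[ Y ∈ subsets m ] (𝟙 (Y ⊆ᵇ Z) * 𝟙 (∣ Y ∣ ≡ᵇ j))
    + ∑[ Y ∈ subsets m ] (𝟙 (Y ⊆ᵇ Z) * 𝟙 (suc ∣ Y ∣ ≡ᵇ j))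
    ≡⟨ cong₂ _+_ (∑-⊆-size≡coeff-1+x^ Z j) (one-larger j) ⟩
  coeff (1+x ^ₚ ∣ Z ∣) j + coeff (+ 0 ∷ 1+x ^ₚ ∣ Z ∣) j
    ≡⟨ sym (coeff-1+x-*ₚ (1+x ^ₚ ∣ Z ∣) j) ⟩
  coeff (1+x ^ₚ suc ∣ Z ∣) j ∎
  where
  open ≡-Reasoning
  one-larger : ∀ j → ∑[ Y ∈ subsets m ] (𝟙 (Y ⊆ᵇ Z) * 𝟙 (suc ∣ Y ∣ ≡ᵇ j))
                   ≡ coeff (+ 0 ∷ 1+x ^ₚ ∣ Z ∣) j
  one-larger zero    = ∑-zero (subsets m) (λ Y → ℤP.*-zeroʳ (𝟙 (Y ⊆ᵇ Z)))
  one-larger (suc j) = ∑-⊆-size≡coeff-1+x^ Z j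

∑-range-sign≡ieWeight : ∀ {s n} → s ℕ.≤ n →
  ∑[ k ∈ List.map suc (upTo n) ] (𝟙 (s ≡ᵇ k) * sign (k ∸ 1)) ≡ ieWeight s
∑-range-sign≡ieWeight {zero}  {n} _         =
  trans (∑-map _ suc (upTo n)) (∑-zero (upTo n) (λ _ → refl))
∑-range-sign≡ieWeight {suc s} {n} s<n =
  trans (∑-map _ suc (upTo n)) (∑-upTo-𝟙 sign s<n)

coeff-inclExcl : ∀ {m} n (X : Fin n → Subset m) j →
  coeff (inclExcl n X) j ≡ ∑[ S ∈ subsets n ] (ieWeight ∣ S ∣ * coeff (1+x ^ₚ ∣ bigCap X S ∣) j)
coeff-inclExcl n X j = begin
  coeff (sumₚ (List.map layer ks)) j
    ≡⟨ trans (coeff-sumₚ (List.map layer ks) j) (∑-map (λ p → coeff p j) layer ks) ⟩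
  ∑[ k ∈ ks ] coeff (layer k) j
    ≡⟨ ∑-cong ks coeff-layer ⟩
  ∑[ k ∈ ks ] ∑[ S ∈ subsets n ] (𝟙 (∣ S ∣ ≡ᵇ k) * sign (k ∸ 1) * c S)
    ≡⟨ ∑-comm (λ k S → 𝟙 (∣ S ∣ ≡ᵇ k) * sign (k ∸ 1) * c S) ks (subsets n) ⟩
  ∑[ S ∈ subsets n ] ∑[ k ∈ ks ] (𝟙 (∣ S ∣ ≡ᵇ k) * sign (k ∸ 1) * c S)
    ≡⟨ ∑-cong (subsets n) (λ S → trans (∑-*ʳ (c S) (λ k → 𝟙 (∣ S ∣ ≡ᵇ k) * sign (k ∸ 1)) ks)
                                       (cong (_* c S) (∑-range-sign≡ieWeight (∣p∣≤n S)))) ⟩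
  ∑[ S ∈ subsets n ] (ieWeight ∣ S ∣ * c S) ∎
  where
  open ≡-Reasoning
  ks = List.map suc (upTo n)
  g : Subset n → Poly
  g S = 1+x ^ₚ ∣ bigCap X S ∣
  c : Subset n → ℤ
  c S = coeff (g S) j
  ofSize : ℕ → List (Subset n)
  ofSize k = filter (λ S → ∣ S ∣ ℕ.≟ k) (subsets n)
  layer : ℕ → Poly
  layer k = const (sign (k ∸ 1)) *ₚ sumₚ (List.map g (ofSize k))
  coeff-layer : ∀ k → coeff (layer k) j ≡ ∑[ S ∈ subsets n ] (𝟙 (∣ S ∣ ≡ᵇ k) * sign (k ∸ 1) * c S)
  coeff-layer k = begin
    coeff (layer k) j
      ≡⟨ coeff-const-*ₚ (sign (k ∸ 1)) (sumₚ (List.map g (ofSize k))) j ⟩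
    sign (k ∸ 1) * coeff (sumₚ (List.map g (ofSize k))) j
      ≡⟨ cong (sign (k ∸ 1) *_) (trans (coeff-sumₚ (List.map g (ofSize k)) j)
                                       (∑-map (λ p → coeff p j) g (ofSize k))) ⟩
    sign (k ∸ 1) * ∑ c (ofSize k)
      ≡⟨ cong (sign (k ∸ 1) *_) (∑-filter (λ S → ∣ S ∣ ℕ.≟ k) c (subsets n)) ⟩
    sign (k ∸ 1) * ∑[ S ∈ subsets n ] (𝟙 (∣ S ∣ ≡ᵇ k) * c S)
      ≡⟨ sym (∑-*ˡ (sign (k ∸ 1)) (λ S → 𝟙 (∣ S ∣ ≡ᵇ k) * c S) (subsets n)) ⟩
    ∑[ S ∈ subsets n ] (sign (k ∸ 1) * (𝟙 (∣ S ∣ ≡ᵇ k) * c S))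
      ≡⟨ ∑-cong (subsets n) (λ S → trans (sym (ℤP.*-assoc (sign (k ∸ 1)) (𝟙 (∣ S ∣ ≡ᵇ k)) (c S)))
                                         (cong (_* c S) (ℤP.*-comm (sign (k ∸ 1)) (𝟙 (∣ S ∣ ≡ᵇ k))))) ⟩
    ∑[ S ∈ subsets n ] (𝟙 (∣ S ∣ ≡ᵇ k) * sign (k ∸ 1) * c S) ∎

∑-⊆-some-size≡coeff-inclExcl : ∀ {m} n (X : Fin n → Subset m) j →
  ∑[ Y ∈ subsets m ] (𝟙 (anyᵇ (λ i → Y ⊆ᵇ X i)) * 𝟙 (∣ Y ∣ ≡ᵇ j)) ≡ coeff (inclExcl n X) j
∑-⊆-some-size≡coeff-inclExcl {m} n X j = begin
  ∑[ Y ∈ subsets m ] (𝟙 (anyᵇ (λ i → Y ⊆ᵇ X i)) * size Y)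
    ≡⟨ ∑-cong (subsets m) (λ Y → cong (_* size Y) (sym (∑-ieWeight-⊆ n (λ i → Y ⊆ᵇ X i)))) ⟩
  ∑[ Y ∈ subsets m ]
    (∑[ S ∈ subsets n ] (ieWeight ∣ S ∣ * 𝟙 (S ⊆ᵇ tabulate (λ i → Y ⊆ᵇ X i))) * size Y)
    ≡⟨ ∑-cong (subsets m) (λ Y → trans (sym (∑-*ʳ (size Y) _ (subsets n)))
                                       (∑-cong (subsets n) (regroup Y))) ⟩
  ∑[ Y ∈ subsets m ] ∑[ S ∈ subsets n ] (ieWeight ∣ S ∣ * (𝟙 (Y ⊆ᵇ bigCap X S) * size Y))
    ≡⟨ ∑-comm (λ Y S → ieWeight ∣ S ∣ * (𝟙 (Y ⊆ᵇ bigCap X S) * size Y)) (subsets m) (subsets n) ⟩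
  ∑[ S ∈ subsets n ] ∑[ Y ∈ subsets m ] (ieWeight ∣ S ∣ * (𝟙 (Y ⊆ᵇ bigCap X S) * size Y))
    ≡⟨ ∑-cong (subsets n) (λ S →
         ∑-*ˡ (ieWeight ∣ S ∣) (λ Y → 𝟙 (Y ⊆ᵇ bigCap X S) * size Y) (subsets m)) ⟩
  ∑[ S ∈ subsets n ] (ieWeight ∣ S ∣ * ∑[ Y ∈ subsets m ] (𝟙 (Y ⊆ᵇ bigCap X S) * size Y))
    ≡⟨ ∑-cong (subsets n) (λ S → cong (ieWeight ∣ S ∣ *_) (∑-⊆-size≡coeff-1+x^ (bigCap X S) j)) ⟩
  ∑[ S ∈ subsets n ] (ieWeight ∣ S ∣ * coeff (1+x ^ₚ ∣ bigCap X S ∣) j)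
    ≡⟨ sym (coeff-inclExcl n X j) ⟩
  coeff (inclExcl n X) j ∎
  where
  open ≡-Reasoning
  size : Subset m → ℤ
  size Y = 𝟙 (∣ Y ∣ ≡ᵇ j)
  regroup : ∀ Y S → ieWeight ∣ S ∣ * 𝟙 (S ⊆ᵇ tabulate (λ i → Y ⊆ᵇ X i)) * size Y
                  ≡ ieWeight ∣ S ∣ * (𝟙 (Y ⊆ᵇ bigCap X S) * size Y)
  regroup Y S = trans (ℤP.*-assoc (ieWeight ∣ S ∣) _ (size Y))
                      (cong (λ b → ieWeight ∣ S ∣ * (𝟙 b * size Y)) (sym (⊆ᵇ-bigCap X S Y)))

Maximal : ∀ {m} → (Subset m → Set) → Subset m → Set
Maximal P Z = P Z × (∀ Y → P Y → Z ⊆ Y → Y ≡ Z)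

Hereditary : ∀ {m} → (Subset m → Set) → Set
Hereditary P = ∀ {Y Z} → Y ⊆ Z → P Z → P Y

p⊂q⇒∣p∣<∣q∣ : ∀ {m} {p q : Subset m} → p ⊂ q → ∣ p ∣ < ∣ q ∣
p⊂q⇒∣p∣<∣q∣ {p = outside ∷ p} {outside ∷ q} p⊂q = p⊂q⇒∣p∣<∣q∣ (drop-∷-⊂ p⊂q)
p⊂q⇒∣p∣<∣q∣ {p = outside ∷ p} {inside  ∷ q} p⊂q = s≤s (p⊆q⇒∣p∣≤∣q∣ (drop-∷-⊆ (p⊂q⇒p⊆q p⊂q)))
p⊂q⇒∣p∣<∣q∣ {p = inside  ∷ p} {inside  ∷ q} p⊂q = s≤s (p⊂q⇒∣p∣<∣q∣ (drop-∷-⊂ p⊂q))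
p⊂q⇒∣p∣<∣q∣ {p = inside  ∷ p} {outside ∷ q} (p⊆q , _) with p⊆q here
... | ()

p⊆q∧p⊄q⇒q⊆p : ∀ {m} {p q : Subset m} → p ⊆ q → p ⊄ q → q ⊆ p
p⊆q∧p⊄q⇒q⊆p {p = p} p⊆q p⊄q {x} x∈q with x ∈? p
... | yes x∈p = x∈p
... | no  x∉p = contradiction ((λ {y} → p⊆q {y}) , x , x∈q , x∉p) p⊄q

∈-subsets : ∀ {m} (Y : Subset m) → Y List∈ subsets m
∈-subsets []                    = Any.here refl
∈-subsets {suc m} (outside ∷ Y) = ∈-++⁺ˡ (∈-map⁺ (outside ∷_) (∈-subsets Y))
∈-subsets {suc m} (inside  ∷ Y) =
  ∈-++⁺ʳ (List.map (outside ∷_) (subsets m)) (∈-map⁺ (inside ∷_) (∈-subsets Y))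

module _ {m} {P : Subset m → Set} (P? : ∀ Y → Dec (P Y)) where

  maximal-extension : ∀ {Y} → P Y → ∃ λ Z → Maximal P Z × Y ⊆ Z
  maximal-extension {Y} pY = go Y pY (<-wellFounded (m ∸ ∣ Y ∣))
    where
    go : ∀ Y → P Y → Acc _<_ (m ∸ ∣ Y ∣) → ∃ λ Z → Maximal P Z × Y ⊆ Z
    go Y pY (acc rec) with any? (λ W → P? W ×-dec Y ⊂? W) (subsets m)
    ... | no none = Y , (pY , maximal) , ⊆-refl
      where
      maximal : ∀ W → P W → Y ⊆ W → W ≡ Y
      maximal W pW Y⊆W =
        ⊆-antisym (p⊆q∧p⊄q⇒q⊆p Y⊆W (λ Y⊂W → none (lose (∈-subsets W) (pW , Y⊂W)))) Y⊆W
    ... | yes some with Any.satisfied some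
    ...   | W , pW , Y⊂W with go W pW (rec (ℕP.∸-monoʳ-< (p⊂q⇒∣p∣<∣q∣ Y⊂W) (∣p∣≤n W)))
    ...     | Z , maxZ , W⊆Z = Z , maxZ , ⊆-trans (p⊂q⇒p⊆q Y⊂W) W⊆Z

module _ {m n} {P : Subset m → Set} (P? : ∀ Y → Dec (P Y)) (P-hereditary : Hereditary P)
         (X : Fin n → Subset m) (X-maximal : ∀ i → Maximal P (X i))
         (X-complete : ∀ Z → Maximal P Z → ∃ λ i → X i ≡ Z) where

  does-P?≡anyᵇ-⊆ : ∀ Y → does (P? Y) ≡ anyᵇ (λ i → Y ⊆ᵇ X i)
  does-P?≡anyᵇ-⊆ Y with P? Y
  ... | yes pY with maximal-extension P? pY
  ...   | Z , maxZ , Y⊆Z with X-complete Z maxZ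
  ...     | i , refl = sym (anyᵇ-intro (λ i → Y ⊆ᵇ X i) i (⊆⇒⊆ᵇ Y (X i) Y⊆Z))
  does-P?≡anyᵇ-⊆ Y | no ¬pY with anyᵇ (λ i → Y ⊆ᵇ X i) in any
  ... | false = refl
  ... | true with anyᵇ-elim (λ i → Y ⊆ᵇ X i) any
  ...   | i , Y⊆ᵇXi = contradiction (P-hereditary (⊆ᵇ⇒⊆ Y (X i) Y⊆ᵇXi) (proj₁ (X-maximal i))) ¬pY

  countSets≡coeff-inclExcl : ∀ j → + countSets P? j ≡ coeff (inclExcl n X) j
  countSets≡coeff-inclExcl j = begin
    + countSets P? j
      ≡⟨ length-filter (λ Y → P? Y ×-dec (∣ Y ∣ ℕ.≟ j)) (subsets m) ⟩
    ∑[ Y ∈ subsets m ] 𝟙 (does (P? Y) ∧ (∣ Y ∣ ≡ᵇ j))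
      ≡⟨ ∑-cong (subsets m) (λ Y → trans (cong (λ b → 𝟙 (b ∧ (∣ Y ∣ ≡ᵇ j))) (does-P?≡anyᵇ-⊆ Y))
                                         (𝟙-∧ (anyᵇ (λ i → Y ⊆ᵇ X i)) (∣ Y ∣ ≡ᵇ j))) ⟩
    ∑[ Y ∈ subsets m ] (𝟙 (anyᵇ (λ i → Y ⊆ᵇ X i)) * 𝟙 (∣ Y ∣ ≡ᵇ j))
      ≡⟨ ∑-⊆-some-size≡coeff-inclExcl n X j ⟩
    coeff (inclExcl n X) j ∎
    where open ≡-Reasoning

Visible-anti : ∀ G {Y Z : Subset (order G)} {x y} → Y ⊆ Z → Visible G Z x y → Visible G Y x y
Visible-anti G Y⊆Z (inj₁ x≡y)           = inj₁ x≡y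
Visible-anti G Y⊆Z (inj₂ (ws , sp , ∉Z)) = inj₂ (ws , sp , All.map (λ w∉Z w∈Y → w∉Z (Y⊆Z w∈Y)) ∉Z)

IsMV-hereditary : ∀ G → Hereditary (IsMV G)
IsMV-hereditary G Y⊆Z mvZ x y x∈Y y∈Y = Visible-anti G Y⊆Z (mvZ x y (Y⊆Z x∈Y) (Y⊆Z y∈Y))

VisProp-hereditary : ∀ κ G → Hereditary (VisProp κ G)
VisProp-hereditary mutualVis G = IsMV-hereditary G
VisProp-hereditary totalVis  G Y⊆Z tvZ x y = Visible-anti G Y⊆Z (tvZ x y)
VisProp-hereditary outerVis  G {Y} {Z} Y⊆Z (mvZ , outZ) = IsMV-hereditary G Y⊆Z mvZ , outY
  where
  outY : ∀ x y → x ∈ Y → y ∉ Y → Visible G Y x y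
  outY x y x∈Y _ with y ∈? Z
  ... | yes y∈Z = Visible-anti G Y⊆Z (mvZ x y (Y⊆Z x∈Y) y∈Z)
  ... | no  y∉Z = Visible-anti G Y⊆Z (outZ x y (Y⊆Z x∈Y) y∉Z)

proposition3p5 : (G : Graph) (κ : Kind)
    → (dec : ∀ X → Dec (VisProp κ G X))
    → (n : ℕ) (X : Fin n → Subset (order G))
    → Injective _≡_ _≡_ X
    → (∀ i → IsMaximal κ G (X i))
    → (∀ Y → IsMaximal κ G Y → ∃ λ i → X i ≡ Y)
    → ∀ j → + (countSets dec j) ≡ coeff (inclExcl n X) j
proposition3p5 G κ dec n X _ X-maximal X-complete =
  countSets≡coeff-inclExcl dec (VisProp-hereditary κ G) X X-maximal X-complete
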